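{- Every weakly directed, connected equivalence frame $F=(W,\sim_1,\dots,\sim_n)$ is directed, i.e. for any $w_1,\dots,w_n\in W$ there exists $w\in W$ with $w_i\sim_iw$ for each $i=1,\dots,n$.
   Context: An equivalence frame has all $\sim_i$ equivalence relations ($W$ nonempty). $F$ is weakly directed if for all $w_0,w_1,\dots,w_n\in W$, whenever for each $i$ there exists $j\in\{1,\dots,n\}$ with $w_0\sim_jw_i$, there exists $w$ with $w_i\sim_iw$ for each $i=1,\dots,n$. $F$ is connected if any two worlds $w,w'$ are joined by a finite sequence $w=u_0,\dots,u_k=w'$ with $u_j\sim_{i_j}u_{j+1}$ for some $i_j$. -}

module Defs where

open import Level using (Level; _⊔_; suc)
open import Data.Nat using (ℕ)
open import Data.Fin using (Fin)
open import Data.Product using (Σ; ∃; _,_)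
open import Relation.Binary using (Rel; IsEquivalence)
open import Relation.Binary.Construct.Closure.ReflexiveTransitive using (Star)

record Frame (n : ℕ) (a ℓ : Level) : Set (Level.suc (a ⊔ ℓ)) where
  field
    W   : Set a
    rel : Fin n → Rel W ℓ

record IsEquivalenceFrame {n a ℓ} (F : Frame n a ℓ) : Set (a ⊔ ℓ) where
  open Frame F
  field
    nonempty : W
    isEquiv  : (i : Fin n) → IsEquivalence (rel i)

module _ {n a ℓ} (F : Frame n a ℓ) where
  open Frame F

  WeaklyDirected : Set (a ⊔ ℓ)
  WeaklyDirected =
    (w₀ : W) (ws : Fin n → W) →
    ((i : Fin n) → ∃ λ (j : Fin n) → rel j w₀ (ws i)) →
    ∃ λ (w : W) → (i : Fin n) → rel i (ws i) w

  Step : Rel W ℓ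
  Step u v = ∃ λ (i : Fin n) → rel i u v

  Connected : Set (a ⊔ ℓ)
  Connected = (w w′ : W) → Star Step w w′

  Directed : Set (a ⊔ ℓ)
  Directed = (ws : Fin n → W) → ∃ λ (w : W) → (i : Fin n) → rel i (ws i) w

{-# OPTIONS --safe #-}
module Submission where

open import Defs
open import Level using (Level; _⊔_)
open import Data.Nat using (ℕ)
open import Data.Fin using (Fin; _≟_)
open import Data.Empty using (⊥-elim)
open import Data.Product using (∃; _×_; _,_)
open import Data.List using (List; []; _∷_; allFin)
open import Data.List.Relation.Unary.Any using (here; there)
open import Data.List.Membership.Propositional using (_∈_)
open import Data.List.Membership.Propositional.Properties using (∈-allFin)
open import Data.Vec.Functional using (Vector; updateAt)
open import Data.Vec.Functional.Properties
  using (updateAt-updates; updateAt-minimal; updateAt-id-local; updateAt-updateAt)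
open import Function using (const)
open import Relation.Nullary using (yes; no)
open import Relation.Binary using (Reflexive; Transitive; IsEquivalence)
open import Relation.Binary.PropositionalEquality
  using (_≡_; _≢_; _≗_; refl; sym; subst)
open import Relation.Binary.Construct.Closure.ReflexiveTransitive using (Star; ε; _◅_)

-- Call a tuple (wᵢ) joinable when some w has wᵢ ∼ᵢ w for all i. If (wᵢ) is
-- joinable with bound w and wₖ ∼ⱼ y, then weak directedness at w₀ = wₖ, applied
-- to the tuple that is y at k and w elsewhere, gives a bound for (wᵢ) with wₖ
-- replaced by y (by transitivity at i ≠ k). By connectedness each coordinate can
-- thus be moved to any world, so starting from a constant tuple, which is
-- joinable by reflexivity, every tuple is joinable.

updateAt-elim : ∀ {n a p} {A : Set a} (P : Fin n → A → Set p) {xs : Vector A n} {k f} →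
                P k (f (xs k)) → (∀ {i} → i ≢ k → P i (xs i)) →
                ∀ i → P i (updateAt xs k f i)
updateAt-elim P {xs} {k} at-k elsewhere i with i ≟ k
... | yes refl = subst (P i) (sym (updateAt-updates i xs)) at-k
... | no i≢k   = subst (P i) (sym (updateAt-minimal i k xs i≢k)) (elsewhere i≢k)

module _ {n a ℓ} (F : Frame n a ℓ) where
  open Frame F

  Joinable : (Fin n → W) → Set (a ⊔ ℓ)
  Joinable ws = ∃ λ (w : W) → (i : Fin n) → rel i (ws i) w

  joinable-resp : ∀ {ws vs} → ws ≗ vs → Joinable ws → Joinable vs
  joinable-resp ws≗vs (w , ws≤w) =
    w , λ i → subst (λ x → rel i x w) (ws≗vs i) (ws≤w i)

  joinable-const : (∀ i → Reflexive (rel i)) → (w : W) → Joinable (const w)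
  joinable-const rel-refl w = w , λ i → rel-refl i

  module _ (rel-trans : ∀ i → Transitive (rel i)) (wd : WeaklyDirected F) where

    joinable-step : ∀ {ws} k {y} →
                    Joinable ws → Step F (ws k) y → Joinable (updateAt ws k (const y))
    joinable-step {ws} k {y} (w , ws≤w) (j , wsₖ∼y) = shift (wd (ws k) vs centred)
      where
      vs : Fin n → W
      vs = updateAt (const w) k (const y)

      centred : (i : Fin n) → ∃ λ j′ → rel j′ (ws k) (vs i)
      centred = updateAt-elim (λ _ x → ∃ λ j′ → rel j′ (ws k) x)
                              (j , wsₖ∼y) (λ _ → k , ws≤w k)

      shift : Joinable vs → Joinable (updateAt ws k (const y))
      shift (v , vs≤v) = v , updateAt-elim (λ i x → rel i x v)
        (subst (λ x → rel k x v) (updateAt-updates k (const w)) (vs≤v k))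
        (λ {i} i≢k → rel-trans i (ws≤w i)
          (subst (λ x → rel i x v) (updateAt-minimal i k (const w) i≢k) (vs≤v i)))

    joinable-star : ∀ {x y} → Star (Step F) x y →
                    ∀ {ws} k → ws k ≡ x → Joinable ws → Joinable (updateAt ws k (const y))
    joinable-star ε {ws} k refl ws-joinable =
      joinable-resp (λ i → sym (updateAt-id-local k ws refl i)) ws-joinable
    joinable-star (s ◅ ss) {ws} k refl ws-joinable =
      joinable-resp (updateAt-updateAt k ws)
        (joinable-star ss k (updateAt-updates k ws) (joinable-step k ws-joinable s))

    module _ (conn : Connected F) {us : Fin n → W} (us-joinable : Joinable us) where

      joinable-agreeing-on : (ws : Fin n → W) (ks : List (Fin n)) →
                             ∃ λ (vs : Fin n → W) →
                               Joinable vs × (∀ {i} → i ∈ ks → vs i ≡ ws i)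
      joinable-agreeing-on ws [] = us , us-joinable , λ ()
      joinable-agreeing-on ws (k ∷ ks)
        with vs , vs-joinable , agree ← joinable-agreeing-on ws ks =
        updateAt vs k (const (ws k)) ,
        joinable-star (conn (vs k) (ws k)) k refl vs-joinable ,
        λ {i} → updateAt-elim (λ i x → i ∈ k ∷ ks → x ≡ ws i)
                              (λ _ → refl) agree-off-k i
        where
        agree-off-k : ∀ {i} → i ≢ k → i ∈ k ∷ ks → vs i ≡ ws i
        agree-off-k i≢k (here i≡k)  = ⊥-elim (i≢k i≡k)
        agree-off-k i≢k (there i∈ks) = agree i∈ks

      all-joinable : (ws : Fin n → W) → Joinable ws
      all-joinable ws
        with vs , vs-joinable , agree ← joinable-agreeing-on ws (allFin n) =
        joinable-resp (λ i → agree (∈-allFin i)) vs-joinable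

lemma3p8 : {n : ℕ} {a ℓ : Level} (F : Frame n a ℓ) → IsEquivalenceFrame F → WeaklyDirected F → Connected F → Directed F
lemma3p8 F E wd conn =
  all-joinable F (λ i → IsEquivalence.trans (isEquiv i)) wd conn
    (joinable-const F (λ i → IsEquivalence.refl (isEquiv i)) nonempty)
  where open IsEquivalenceFrame E
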